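{- For each of the eight unordered pairs of types $\{\tau,\tau'\}\in\{\{\mathrm S,\mathrm X\},\{\mathrm U,\mathrm U\},\{\mathrm U,\mathrm W\},\{\mathrm U,\mathrm X\},\{\mathrm V,\mathrm X\},\{\mathrm W,\mathrm W\},\{\mathrm W,\mathrm X\},\{\mathrm X,\mathrm X\}\}$ there exist coloured Latin squares $P$ and $Q$ of order $10$ such that: $P$ is an admissible coloured square of type $\tau$, $Q$ is an admissible coloured square of type $\tau'$, $(P,Q)$ is a transversal representation pair, the colourings of $P$ and $Q$ are consistent, and there is $\Omega\in\{\Omega_1,\Omega_2\}$ with which both $P$ and $Q$ are compatible.
   Context: All squares have rows and columns indexed by $\{0,\dots,9\}$ and symbols in $\{0,\dots,9\}$. Two $10\times10$ Latin squares $A,B$ form a transversal representation pair (TRP) if for all $i,i',j,j'$: $A[i,j]=B[i',j]$ and $A[i,j']=B[i',j']$ imply $j=j'$. A coloured square is a Latin square $P$ each of whose cells is coloured white, light, or dark. It is an admissible coloured square of type $\tau$ if: (i) cell $(i,j)$ is white if and only if $P[i,j]\in\{0,1,2,3\}$; (ii) every dark cell lies in columns $0,\dots,5$ and has symbol in $\{4,\dots,9\}$, and each of the columns $0,\dots,5$ contains exactly two dark cells; (iii) every row $i$ is of some type $p_k$ with $k\in\{1,2,3,4\}$, meaning that row $i$ has exactly $k$ white cells among columns $6,\dots,9$ and exactly $2k-2$ dark cells among columns $0,\dots,5$; and (iv) letting $n_k$ be the number of rows of type $p_k$, the vector $(n_1,n_2,n_3,n_4)$ equals: $(8,0,0,2)$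 for $\tau=\mathrm R$; $(7,0,3,0)$ for $\mathrm S$; $(7,1,1,1)$ for $\mathrm T$; $(6,2,2,0)$ for $\mathrm U$; $(6,3,0,1)$ for $\mathrm V$; $(5,4,1,0)$ for $\mathrm W$; $(4,6,0,0)$ for $\mathrm X$. The colourings of $P$ and $Q$ are consistent if for every column $j\in\{0,\dots,5\}$ and every symbol $k\in\{4,\dots,9\}$, the cell of column $j$ of $P$ containing $k$ is dark if and only if the cell of column $j$ of $Q$ containing $k$ is dark. $\Omega_1$ is the $4\times4$ Latin square with rows $[0,1,2,3],[1,2,3,0],[2,3,0,1],[3,0,1,2]$, and $\Omega_2$ is the one with rows $[0,1,2,3],[1,0,3,2],[2,3,0,1],[3,2,1,0]$ (rows and columns indexed $0,\dots,3$). A Latin square $P$ is compatible with $\Omega$ if there are no row $i$ of $P$, row $r\in\{0,1,2,3\}$ of $\Omega$, and columns $6\le j<j'\le 9$ with $P[i,j]=\Omega[r,j-6]$ and $P[i,j']=\Omega[r,j'-6]$. -}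

module Defs where

open import Data.Nat using (ℕ; zero; suc; _+_; _*_; _∸_; _≤_; _<_)
open import Data.Fin using (Fin; toℕ)
open import Data.List using (List; length; filter; allFin; [])
open import Data.List.Relation.Unary.Any using (Any)
open import Data.Product using (_×_; Σ; ∃; _,_)
open import Data.Sum using (_⊎_)
open import Relation.Binary.PropositionalEquality using (_≡_)
open import Relation.Nullary using (¬_; Dec; yes; no)
open import Relation.Unary using (Decidable)
open import Function.Definitions using (Injective)
open import Data.Vec using (Vec; lookup; _∷_; [])

Square : Set
Square = Fin 10 → Fin 10 → Fin 10

IsLatin : Square → Set
IsLatin A = (∀ i → Injective _≡_ _≡_ (λ j → A i j))
          × (∀ j → Injective _≡_ _≡_ (λ i → A i j))

IsTRP : Square → Square → Set
IsTRP A B = ∀ i i' j j' → A i j ≡ B i' j → A i j' ≡ B i' j' → j ≡ j'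

data Colour : Set where
  white light dark : Colour

isDark : (c : Colour) → Dec (c ≡ dark)
isDark white = no λ ()
isDark light = no λ ()
isDark dark  = yes _≡_.refl

isWhite : (c : Colour) → Dec (c ≡ white)
isWhite white = yes _≡_.refl
isWhite light = no λ ()
isWhite dark  = no λ ()

record ColouredSquare : Set where
  field
    sq      : Square
    latin   : IsLatin sq
    colour  : Fin 10 → Fin 10 → Colour
open ColouredSquare public

inCols0-5 : (j : Fin 10) → Dec (toℕ j < 6)
inCols0-5 j = suc (toℕ j) Data.Nat.≤? 6
  where import Data.Nat

inCols6-9 : (j : Fin 10) → Dec (6 ≤ toℕ j)
inCols6-9 j = 6 Data.Nat.≤? toℕ j
  where import Data.Nat

decAnd : {A B : Set} → Dec A → Dec B → Dec (A × B)
decAnd (yes a) (yes b) = yes (a , b)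
decAnd (no na) _ = no λ { (a , _) → na a }
decAnd (yes _) (no nb) = no λ { (_ , b) → nb b }

whiteRight : ColouredSquare → Fin 10 → ℕ
whiteRight P i = length (filter (λ j → decAnd (inCols6-9 j) (isWhite (colour P i j))) (allFin 10))

darkLeft : ColouredSquare → Fin 10 → ℕ
darkLeft P i = length (filter (λ j → decAnd (inCols0-5 j) (isDark (colour P i j))) (allFin 10))

darkInCol : ColouredSquare → Fin 10 → ℕ
darkInCol P j = length (filter (λ i → isDark (colour P i j)) (allFin 10))

RowType : ColouredSquare → Fin 10 → ℕ → Set
RowType P i k = (whiteRight P i ≡ k) × (darkLeft P i ≡ 2 * k ∸ 2)

rowType? : (P : ColouredSquare) (i : Fin 10) (k : ℕ) → Dec (RowType P i k)
rowType? P i k = decAnd (whiteRight P i Data.Nat.≟ k) (darkLeft P i Data.Nat.≟ (2 * k ∸ 2))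
  where import Data.Nat

nType : ColouredSquare → ℕ → ℕ
nType P k = length (filter (λ i → rowType? P i k) (allFin 10))

data Type : Set where
  R S T U V W X : Type

-- (n_1, n_2, n_3, n_4) for each type
typeVector : Type → Vec ℕ 4
typeVector R = 8 ∷ 0 ∷ 0 ∷ 2 ∷ []
typeVector S = 7 ∷ 0 ∷ 3 ∷ 0 ∷ []
typeVector T = 7 ∷ 1 ∷ 1 ∷ 1 ∷ []
typeVector U = 6 ∷ 2 ∷ 2 ∷ 0 ∷ []
typeVector V = 6 ∷ 3 ∷ 0 ∷ 1 ∷ []
typeVector W = 5 ∷ 4 ∷ 1 ∷ 0 ∷ []
typeVector X = 4 ∷ 6 ∷ 0 ∷ 0 ∷ []

Admissible : Type → ColouredSquare → Set
Admissible τ P =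
  (∀ i j → (colour P i j ≡ white → toℕ (sq P i j) < 4)
         × (toℕ (sq P i j) < 4 → colour P i j ≡ white))
  × (∀ i j → colour P i j ≡ dark → (toℕ j < 6) × (4 ≤ toℕ (sq P i j)))
  × (∀ j → toℕ j < 6 → darkInCol P j ≡ 2)
  × (∀ i → Σ ℕ λ k → (1 ≤ k) × (k ≤ 4) × RowType P i k)
  × (∀ (m : Fin 4) → nType P (suc (toℕ m)) ≡ lookup (typeVector τ) m)

Consistent : ColouredSquare → ColouredSquare → Set
Consistent P Q = ∀ j i i' → toℕ j < 6 → 4 ≤ toℕ (sq P i j) → sq P i j ≡ sq Q i' j →
  (colour P i j ≡ dark → colour Q i' j ≡ dark) × (colour Q i' j ≡ dark → colour P i j ≡ dark)

Sq4 : Set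
Sq4 = Fin 4 → Fin 4 → ℕ

Ω₁ : Sq4
Ω₁ r c = lookup (lookup rows r) c
  where
  rows : Vec (Vec ℕ 4) 4
  rows = (0 ∷ 1 ∷ 2 ∷ 3 ∷ []) ∷ (1 ∷ 2 ∷ 3 ∷ 0 ∷ []) ∷ (2 ∷ 3 ∷ 0 ∷ 1 ∷ []) ∷ (3 ∷ 0 ∷ 1 ∷ 2 ∷ []) ∷ []

Ω₂ : Sq4
Ω₂ r c = lookup (lookup rows r) c
  where
  rows : Vec (Vec ℕ 4) 4
  rows = (0 ∷ 1 ∷ 2 ∷ 3 ∷ []) ∷ (1 ∷ 0 ∷ 3 ∷ 2 ∷ []) ∷ (2 ∷ 3 ∷ 0 ∷ 1 ∷ []) ∷ (3 ∷ 2 ∷ 1 ∷ 0 ∷ []) ∷ []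

col6+ : Fin 4 → Fin 10
col6+ a = 6 Data.Fin.↑ʳ a
  where import Data.Fin

Compatible : Square → Sq4 → Set
Compatible P Ω = ∀ (i : Fin 10) (r a b : Fin 4) → toℕ a < toℕ b →
  ¬ ((toℕ (P i (col6+ a)) ≡ Ω r a) × (toℕ (P i (col6+ b)) ≡ Ω r b))

data Pair : Type → Type → Set where
  SX : Pair S X
  UU : Pair U U
  UW : Pair U W
  UX : Pair U X
  VX : Pair V X
  WW : Pair W W
  WX : Pair W X
  XX : Pair X X

{-# OPTIONS --safe #-}
module Submission where

-- Each of the eight pairs is realised by an explicit pair of coloured squares found by
-- computer search. Every condition in the theorem quantifies only over rows, columns and
-- symbols of bounded range, so it is decidable, and the sixteen squares are certified by
-- evaluating the decision procedures.

open import Defs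
open import Data.Fin using (Fin; toℕ; #_) renaming (_≟_ to _≟ᶠ_)
open import Data.Fin.Properties using (all?)
open import Data.Nat using (ℕ; suc; _≤_; _<?_; _≤?_; _≟_)
open import Data.Product using (_×_; Σ; _,_)
open import Data.Sum using (_⊎_)
open import Data.Vec using (Vec; lookup; _∷_; [])
open import Function.Definitions using (Injective)
open import Relation.Binary.PropositionalEquality using (_≡_; sym; subst)
open import Relation.Nullary using (Dec; yes; no; ¬?)
open import Relation.Nullary.Decidable using (True; toWitness; map′; _×-dec_; _⊎-dec_; _→-dec_)

injective? : ∀ {m n} (f : Fin m → Fin n) → Dec (Injective _≡_ _≡_ f)
injective? f = map′ (λ inj {x} {y} → inj x y) (λ inj x y → inj)
  (all? λ x → all? λ y → f x ≟ᶠ f y →-dec x ≟ᶠ y)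

isLatin? : (A : Square) → Dec (IsLatin A)
isLatin? A = all? (λ i → injective? (A i)) ×-dec all? (λ j → injective? (λ i → A i j))

isTRP? : (A B : Square) → Dec (IsTRP A B)
isTRP? A B = all? λ i → all? λ i' → all? λ j → all? λ j' →
  A i j ≟ᶠ B i' j →-dec (A i j' ≟ᶠ B i' j' →-dec j ≟ᶠ j')

-- The k of a row type is forced: it is the number of white cells in columns 6..9.
hasRowType? : (P : ColouredSquare) (i : Fin 10) →
  Dec (Σ ℕ λ k → (1 ≤ k) × (k ≤ 4) × RowType P i k)
hasRowType? P i = map′ (λ h → whiteRight P i , h) forced
  (1 ≤? whiteRight P i ×-dec whiteRight P i ≤? 4 ×-dec rowType? P i (whiteRight P i))
  where
  forced : Σ ℕ (λ k → (1 ≤ k) × (k ≤ 4) × RowType P i k) →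
    (1 ≤ whiteRight P i) × (whiteRight P i ≤ 4) × RowType P i (whiteRight P i)
  forced (k , h@(_ , _ , white≡k , _)) =
    subst (λ k → (1 ≤ k) × (k ≤ 4) × RowType P i k) (sym white≡k) h

admissible? : (τ : Type) (P : ColouredSquare) → Dec (Admissible τ P)
admissible? τ P =
  all? (λ i → all? λ j → (isWhite (colour P i j) →-dec toℕ (sq P i j) <? 4)
                    ×-dec (toℕ (sq P i j) <? 4 →-dec isWhite (colour P i j)))
  ×-dec all? (λ i → all? λ j → isDark (colour P i j) →-dec (toℕ j <? 6 ×-dec 4 ≤? toℕ (sq P i j)))
  ×-dec all? (λ j → toℕ j <? 6 →-dec darkInCol P j ≟ 2)
  ×-dec all? (hasRowType? P)
  ×-dec all? (λ m → nType P (suc (toℕ m)) ≟ lookup (typeVector τ) m)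

consistent? : (P Q : ColouredSquare) → Dec (Consistent P Q)
consistent? P Q = all? λ j → all? λ i → all? λ i' →
  toℕ j <? 6 →-dec (4 ≤? toℕ (sq P i j) →-dec (sq P i j ≟ᶠ sq Q i' j →-dec
    ((isDark (colour P i j) →-dec isDark (colour Q i' j))
      ×-dec (isDark (colour Q i' j) →-dec isDark (colour P i j)))))

compatible? : (A : Square) (Ω : Sq4) → Dec (Compatible A Ω)
compatible? A Ω = all? λ i → all? λ r → all? λ a → all? λ b → toℕ a <? toℕ b →-dec
  ¬? (toℕ (A i (col6+ a)) ≟ Ω r a ×-dec toℕ (A i (col6+ b)) ≟ Ω r b)

Realises : Type → Type → ColouredSquare → ColouredSquare → Set
Realises τ τ' P Q =
  Admissible τ P × Admissible τ' Q × IsTRP (sq P) (sq Q) × Consistent P Q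
  × ((Compatible (sq P) Ω₁ × Compatible (sq Q) Ω₁) ⊎ (Compatible (sq P) Ω₂ × Compatible (sq Q) Ω₂))

realises? : (τ τ' : Type) (P Q : ColouredSquare) → Dec (Realises τ τ' P Q)
realises? τ τ' P Q =
  admissible? τ P ×-dec admissible? τ' Q ×-dec isTRP? (sq P) (sq Q) ×-dec consistent? P Q
  ×-dec ((compatible? (sq P) Ω₁ ×-dec compatible? (sq Q) Ω₁)
          ⊎-dec (compatible? (sq P) Ω₂ ×-dec compatible? (sq Q) Ω₂))

-- A cell is written as its symbol, prefixed by ● if it is dark and by ○ otherwise; the
-- colour of a ○ cell is then forced by condition (i): white for symbols 0..3, else light.
data Cell : Set where
  plain shaded : Fin 10 → Cell

○_ ●_ : (m : ℕ) {m<10 : True (m <? 10)} → Cell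
(○ m) {m<10} = plain ((# m) {m<n = m<10})
(● m) {m<10} = shaded ((# m) {m<n = m<10})

symbol : Cell → Fin 10
symbol (plain s)  = s
symbol (shaded s) = s

cellColour : Cell → Colour
cellColour (shaded _) = dark
cellColour (plain s) with toℕ s <? 4
... | yes _ = white
... | no _  = light

symbols : Vec (Vec Cell 10) 10 → Square
symbols cells i j = symbol (lookup (lookup cells i) j)

colouredSquare : (cells : Vec (Vec Cell 10) 10) → {True (isLatin? (symbols cells))} →
  ColouredSquare
colouredSquare cells {latin} = record
  { sq     = symbols cells
  ; latin  = toWitness latin
  ; colour = λ i j → cellColour (lookup (lookup cells i) j)
  }

PSX : ColouredSquare
PSX = colouredSquare
  ( (○ 4 ∷ ○ 8 ∷ ○ 2 ∷ ○ 7 ∷ ○ 0 ∷ ○ 3 ∷ ○ 9 ∷ ○ 6 ∷ ○ 5 ∷ ○ 1 ∷ [])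
  ∷ (○ 1 ∷ ○ 3 ∷ ○ 8 ∷ ○ 2 ∷ ○ 7 ∷ ○ 9 ∷ ○ 6 ∷ ○ 0 ∷ ○ 4 ∷ ○ 5 ∷ [])
  ∷ (○ 3 ∷ ○ 4 ∷ ○ 5 ∷ ○ 6 ∷ ○ 1 ∷ ○ 2 ∷ ○ 8 ∷ ○ 9 ∷ ○ 7 ∷ ○ 0 ∷ [])
  ∷ (○ 2 ∷ ● 5 ∷ ● 9 ∷ ● 4 ∷ ○ 8 ∷ ● 6 ∷ ○ 1 ∷ ○ 7 ∷ ○ 0 ∷ ○ 3 ∷ [])
  ∷ (● 7 ∷ ○ 2 ∷ ● 6 ∷ ● 8 ∷ ● 4 ∷ ○ 5 ∷ ○ 0 ∷ ○ 3 ∷ ○ 1 ∷ ○ 9 ∷ [])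
  ∷ (○ 6 ∷ ○ 7 ∷ ○ 4 ∷ ○ 1 ∷ ○ 2 ∷ ○ 0 ∷ ○ 3 ∷ ○ 5 ∷ ○ 9 ∷ ○ 8 ∷ [])
  ∷ (○ 5 ∷ ○ 1 ∷ ○ 3 ∷ ○ 0 ∷ ○ 9 ∷ ○ 8 ∷ ○ 4 ∷ ○ 2 ∷ ○ 6 ∷ ○ 7 ∷ [])
  ∷ (● 8 ∷ ● 6 ∷ ○ 0 ∷ ○ 9 ∷ ● 5 ∷ ● 7 ∷ ○ 2 ∷ ○ 1 ∷ ○ 3 ∷ ○ 4 ∷ [])
  ∷ (○ 9 ∷ ○ 0 ∷ ○ 1 ∷ ○ 5 ∷ ○ 3 ∷ ○ 4 ∷ ○ 7 ∷ ○ 8 ∷ ○ 2 ∷ ○ 6 ∷ [])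
  ∷ (○ 0 ∷ ○ 9 ∷ ○ 7 ∷ ○ 3 ∷ ○ 6 ∷ ○ 1 ∷ ○ 5 ∷ ○ 4 ∷ ○ 8 ∷ ○ 2 ∷ [])
  ∷ [] )

QSX : ColouredSquare
QSX = colouredSquare
  ( (○ 6 ∷ ○ 0 ∷ ○ 3 ∷ ○ 7 ∷ ○ 8 ∷ ○ 2 ∷ ○ 5 ∷ ○ 1 ∷ ○ 4 ∷ ○ 9 ∷ [])
  ∷ (○ 5 ∷ ○ 9 ∷ ○ 0 ∷ ○ 2 ∷ ● 4 ∷ ● 6 ∷ ○ 3 ∷ ○ 8 ∷ ○ 7 ∷ ○ 1 ∷ [])
  ∷ (○ 3 ∷ ○ 8 ∷ ○ 1 ∷ ○ 9 ∷ ○ 2 ∷ ○ 5 ∷ ○ 6 ∷ ○ 4 ∷ ○ 0 ∷ ○ 7 ∷ [])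
  ∷ (○ 2 ∷ ○ 3 ∷ ○ 7 ∷ ○ 5 ∷ ○ 9 ∷ ○ 0 ∷ ○ 8 ∷ ○ 6 ∷ ○ 1 ∷ ○ 4 ∷ [])
  ∷ (● 7 ∷ ○ 4 ∷ ○ 2 ∷ ○ 3 ∷ ● 5 ∷ ○ 8 ∷ ○ 1 ∷ ○ 0 ∷ ○ 9 ∷ ○ 6 ∷ [])
  ∷ (○ 4 ∷ ● 5 ∷ ○ 8 ∷ ○ 1 ∷ ○ 3 ∷ ● 7 ∷ ○ 0 ∷ ○ 9 ∷ ○ 6 ∷ ○ 2 ∷ [])
  ∷ (○ 1 ∷ ○ 2 ∷ ○ 5 ∷ ○ 0 ∷ ○ 6 ∷ ○ 4 ∷ ○ 9 ∷ ○ 7 ∷ ○ 3 ∷ ○ 8 ∷ [])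
  ∷ (● 8 ∷ ○ 7 ∷ ● 9 ∷ ○ 6 ∷ ○ 0 ∷ ○ 1 ∷ ○ 4 ∷ ○ 3 ∷ ○ 2 ∷ ○ 5 ∷ [])
  ∷ (○ 9 ∷ ○ 1 ∷ ● 6 ∷ ● 4 ∷ ○ 7 ∷ ○ 3 ∷ ○ 2 ∷ ○ 5 ∷ ○ 8 ∷ ○ 0 ∷ [])
  ∷ (○ 0 ∷ ● 6 ∷ ○ 4 ∷ ● 8 ∷ ○ 1 ∷ ○ 9 ∷ ○ 7 ∷ ○ 2 ∷ ○ 5 ∷ ○ 3 ∷ [])
  ∷ [] )

PUU : ColouredSquare
PUU = colouredSquare
  ( (○ 1 ∷ ○ 2 ∷ ○ 5 ∷ ○ 4 ∷ ○ 9 ∷ ○ 3 ∷ ○ 6 ∷ ○ 7 ∷ ○ 0 ∷ ○ 8 ∷ [])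
  ∷ (○ 2 ∷ ○ 5 ∷ ○ 6 ∷ ○ 8 ∷ ○ 3 ∷ ○ 0 ∷ ○ 7 ∷ ○ 1 ∷ ○ 4 ∷ ○ 9 ∷ [])
  ∷ (○ 5 ∷ ● 6 ∷ ● 7 ∷ ● 9 ∷ ○ 0 ∷ ● 4 ∷ ○ 1 ∷ ○ 2 ∷ ○ 8 ∷ ○ 3 ∷ [])
  ∷ (● 6 ∷ ○ 7 ∷ ○ 1 ∷ ○ 3 ∷ ● 4 ∷ ○ 5 ∷ ○ 2 ∷ ○ 8 ∷ ○ 9 ∷ ○ 0 ∷ [])
  ∷ (○ 7 ∷ ○ 1 ∷ ○ 2 ∷ ○ 0 ∷ ○ 5 ∷ ○ 6 ∷ ○ 8 ∷ ○ 9 ∷ ○ 3 ∷ ○ 4 ∷ [])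
  ∷ (○ 0 ∷ ○ 4 ∷ ● 8 ∷ ○ 2 ∷ ○ 6 ∷ ● 7 ∷ ○ 9 ∷ ○ 3 ∷ ○ 1 ∷ ○ 5 ∷ [])
  ∷ (● 4 ∷ ● 8 ∷ ○ 9 ∷ ● 5 ∷ ● 7 ∷ ○ 1 ∷ ○ 3 ∷ ○ 0 ∷ ○ 2 ∷ ○ 6 ∷ [])
  ∷ (○ 8 ∷ ○ 9 ∷ ○ 3 ∷ ○ 6 ∷ ○ 1 ∷ ○ 2 ∷ ○ 0 ∷ ○ 4 ∷ ○ 5 ∷ ○ 7 ∷ [])
  ∷ (○ 9 ∷ ○ 3 ∷ ○ 0 ∷ ○ 7 ∷ ○ 2 ∷ ○ 8 ∷ ○ 4 ∷ ○ 5 ∷ ○ 6 ∷ ○ 1 ∷ [])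
  ∷ (○ 3 ∷ ○ 0 ∷ ○ 4 ∷ ○ 1 ∷ ○ 8 ∷ ○ 9 ∷ ○ 5 ∷ ○ 6 ∷ ○ 7 ∷ ○ 2 ∷ [])
  ∷ [] )

QUU : ColouredSquare
QUU = colouredSquare
  ( (● 4 ∷ ○ 5 ∷ ● 7 ∷ ○ 1 ∷ ○ 9 ∷ ○ 2 ∷ ○ 8 ∷ ○ 3 ∷ ○ 6 ∷ ○ 0 ∷ [])
  ∷ (○ 8 ∷ ○ 3 ∷ ○ 5 ∷ ○ 0 ∷ ● 7 ∷ ● 4 ∷ ○ 2 ∷ ○ 6 ∷ ○ 1 ∷ ○ 9 ∷ [])
  ∷ (○ 9 ∷ ○ 0 ∷ ○ 2 ∷ ○ 4 ∷ ○ 6 ∷ ○ 1 ∷ ○ 7 ∷ ○ 8 ∷ ○ 5 ∷ ○ 3 ∷ [])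
  ∷ (○ 0 ∷ ○ 2 ∷ ○ 9 ∷ ○ 3 ∷ ○ 8 ∷ ○ 6 ∷ ○ 1 ∷ ○ 5 ∷ ○ 4 ∷ ○ 7 ∷ [])
  ∷ (○ 7 ∷ ○ 4 ∷ ○ 0 ∷ ○ 8 ∷ ○ 1 ∷ ○ 3 ∷ ○ 5 ∷ ○ 2 ∷ ○ 9 ∷ ○ 6 ∷ [])
  ∷ (○ 5 ∷ ○ 9 ∷ ○ 1 ∷ ○ 2 ∷ ○ 3 ∷ ○ 8 ∷ ○ 6 ∷ ○ 0 ∷ ○ 7 ∷ ○ 4 ∷ [])
  ∷ (○ 1 ∷ ○ 7 ∷ ○ 4 ∷ ○ 6 ∷ ○ 2 ∷ ○ 0 ∷ ○ 3 ∷ ○ 9 ∷ ○ 8 ∷ ○ 5 ∷ [])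
  ∷ (○ 3 ∷ ○ 1 ∷ ○ 6 ∷ ○ 7 ∷ ○ 0 ∷ ○ 5 ∷ ○ 9 ∷ ○ 4 ∷ ○ 2 ∷ ○ 8 ∷ [])
  ∷ (● 6 ∷ ● 8 ∷ ○ 3 ∷ ● 9 ∷ ○ 5 ∷ ● 7 ∷ ○ 4 ∷ ○ 1 ∷ ○ 0 ∷ ○ 2 ∷ [])
  ∷ (○ 2 ∷ ● 6 ∷ ● 8 ∷ ● 5 ∷ ● 4 ∷ ○ 9 ∷ ○ 0 ∷ ○ 7 ∷ ○ 3 ∷ ○ 1 ∷ [])
  ∷ [] )

PUW : ColouredSquare
PUW = colouredSquare
  ( (○ 9 ∷ ○ 7 ∷ ○ 1 ∷ ○ 3 ∷ ○ 8 ∷ ○ 2 ∷ ○ 4 ∷ ○ 5 ∷ ○ 6 ∷ ○ 0 ∷ [])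
  ∷ (○ 6 ∷ ○ 5 ∷ ○ 2 ∷ ○ 0 ∷ ○ 7 ∷ ○ 1 ∷ ○ 8 ∷ ○ 3 ∷ ○ 4 ∷ ○ 9 ∷ [])
  ∷ (○ 1 ∷ ○ 0 ∷ ○ 6 ∷ ○ 8 ∷ ○ 9 ∷ ○ 3 ∷ ○ 7 ∷ ○ 4 ∷ ○ 2 ∷ ○ 5 ∷ [])
  ∷ (○ 2 ∷ ○ 4 ∷ ○ 7 ∷ ○ 1 ∷ ○ 5 ∷ ○ 0 ∷ ○ 6 ∷ ○ 8 ∷ ○ 9 ∷ ○ 3 ∷ [])
  ∷ (○ 0 ∷ ○ 2 ∷ ○ 4 ∷ ○ 9 ∷ ○ 3 ∷ ○ 7 ∷ ○ 5 ∷ ○ 6 ∷ ○ 8 ∷ ○ 1 ∷ [])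
  ∷ (○ 3 ∷ ● 9 ∷ ○ 8 ∷ ○ 2 ∷ ● 4 ∷ ○ 5 ∷ ○ 1 ∷ ○ 0 ∷ ○ 7 ∷ ○ 6 ∷ [])
  ∷ (○ 5 ∷ ○ 3 ∷ ● 9 ∷ ○ 6 ∷ ○ 0 ∷ ● 8 ∷ ○ 2 ∷ ○ 7 ∷ ○ 1 ∷ ○ 4 ∷ [])
  ∷ (● 8 ∷ ● 6 ∷ ● 5 ∷ ● 4 ∷ ○ 1 ∷ ○ 9 ∷ ○ 3 ∷ ○ 2 ∷ ○ 0 ∷ ○ 7 ∷ [])
  ∷ (○ 4 ∷ ○ 1 ∷ ○ 3 ∷ ○ 7 ∷ ○ 2 ∷ ○ 6 ∷ ○ 0 ∷ ○ 9 ∷ ○ 5 ∷ ○ 8 ∷ [])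
  ∷ (● 7 ∷ ○ 8 ∷ ○ 0 ∷ ● 5 ∷ ● 6 ∷ ● 4 ∷ ○ 9 ∷ ○ 1 ∷ ○ 3 ∷ ○ 2 ∷ [])
  ∷ [] )

QUW : ColouredSquare
QUW = colouredSquare
  ( (● 8 ∷ ○ 1 ∷ ● 9 ∷ ● 5 ∷ ● 4 ∷ ○ 7 ∷ ○ 6 ∷ ○ 3 ∷ ○ 2 ∷ ○ 0 ∷ [])
  ∷ (○ 1 ∷ ○ 8 ∷ ○ 4 ∷ ○ 6 ∷ ○ 2 ∷ ○ 0 ∷ ○ 3 ∷ ○ 5 ∷ ○ 7 ∷ ○ 9 ∷ [])
  ∷ (○ 3 ∷ ○ 7 ∷ ○ 0 ∷ ○ 9 ∷ ○ 1 ∷ ○ 6 ∷ ○ 2 ∷ ○ 8 ∷ ○ 4 ∷ ○ 5 ∷ [])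
  ∷ (● 7 ∷ ● 9 ∷ ○ 6 ∷ ○ 3 ∷ ○ 5 ∷ ○ 1 ∷ ○ 0 ∷ ○ 2 ∷ ○ 8 ∷ ○ 4 ∷ [])
  ∷ (○ 2 ∷ ○ 3 ∷ ● 5 ∷ ○ 7 ∷ ○ 9 ∷ ● 4 ∷ ○ 8 ∷ ○ 0 ∷ ○ 6 ∷ ○ 1 ∷ [])
  ∷ (○ 4 ∷ ○ 0 ∷ ○ 2 ∷ ○ 1 ∷ ○ 8 ∷ ○ 9 ∷ ○ 5 ∷ ○ 7 ∷ ○ 3 ∷ ○ 6 ∷ [])
  ∷ (○ 6 ∷ ○ 2 ∷ ○ 3 ∷ ○ 8 ∷ ○ 0 ∷ ○ 5 ∷ ○ 4 ∷ ○ 1 ∷ ○ 9 ∷ ○ 7 ∷ [])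
  ∷ (○ 9 ∷ ● 6 ∷ ○ 7 ∷ ○ 0 ∷ ○ 3 ∷ ● 8 ∷ ○ 1 ∷ ○ 4 ∷ ○ 5 ∷ ○ 2 ∷ [])
  ∷ (○ 5 ∷ ○ 4 ∷ ○ 1 ∷ ○ 2 ∷ ○ 7 ∷ ○ 3 ∷ ○ 9 ∷ ○ 6 ∷ ○ 0 ∷ ○ 8 ∷ [])
  ∷ (○ 0 ∷ ○ 5 ∷ ○ 8 ∷ ● 4 ∷ ● 6 ∷ ○ 2 ∷ ○ 7 ∷ ○ 9 ∷ ○ 1 ∷ ○ 3 ∷ [])
  ∷ [] )

PUX : ColouredSquare
PUX = colouredSquare
  ( (○ 3 ∷ ○ 2 ∷ ○ 8 ∷ ○ 0 ∷ ○ 7 ∷ ○ 5 ∷ ○ 4 ∷ ○ 6 ∷ ○ 1 ∷ ○ 9 ∷ [])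
  ∷ (○ 0 ∷ ○ 7 ∷ ○ 3 ∷ ○ 1 ∷ ○ 9 ∷ ○ 8 ∷ ○ 5 ∷ ○ 2 ∷ ○ 4 ∷ ○ 6 ∷ [])
  ∷ (○ 9 ∷ ○ 3 ∷ ○ 0 ∷ ● 8 ∷ ● 4 ∷ ○ 6 ∷ ○ 1 ∷ ○ 5 ∷ ○ 2 ∷ ○ 7 ∷ [])
  ∷ (○ 4 ∷ ● 6 ∷ ○ 7 ∷ ● 5 ∷ ○ 2 ∷ ○ 0 ∷ ○ 3 ∷ ○ 8 ∷ ○ 9 ∷ ○ 1 ∷ [])
  ∷ (○ 1 ∷ ○ 4 ∷ ○ 5 ∷ ○ 6 ∷ ○ 3 ∷ ○ 2 ∷ ○ 7 ∷ ○ 9 ∷ ○ 0 ∷ ○ 8 ∷ [])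
  ∷ (● 5 ∷ ○ 1 ∷ ● 9 ∷ ○ 7 ∷ ● 6 ∷ ● 4 ∷ ○ 2 ∷ ○ 0 ∷ ○ 8 ∷ ○ 3 ∷ [])
  ∷ (○ 8 ∷ ○ 5 ∷ ○ 2 ∷ ○ 3 ∷ ○ 0 ∷ ○ 7 ∷ ○ 9 ∷ ○ 1 ∷ ○ 6 ∷ ○ 4 ∷ [])
  ∷ (○ 6 ∷ ○ 9 ∷ ○ 1 ∷ ○ 2 ∷ ○ 5 ∷ ○ 3 ∷ ○ 8 ∷ ○ 4 ∷ ○ 7 ∷ ○ 0 ∷ [])
  ∷ (○ 2 ∷ ○ 0 ∷ ○ 4 ∷ ○ 9 ∷ ○ 8 ∷ ○ 1 ∷ ○ 6 ∷ ○ 7 ∷ ○ 3 ∷ ○ 5 ∷ [])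
  ∷ (● 7 ∷ ● 8 ∷ ● 6 ∷ ○ 4 ∷ ○ 1 ∷ ● 9 ∷ ○ 0 ∷ ○ 3 ∷ ○ 5 ∷ ○ 2 ∷ [])
  ∷ [] )

QUX : ColouredSquare
QUX = colouredSquare
  ( (● 5 ∷ ○ 3 ∷ ○ 7 ∷ ○ 2 ∷ ○ 8 ∷ ● 9 ∷ ○ 4 ∷ ○ 1 ∷ ○ 0 ∷ ○ 6 ∷ [])
  ∷ (○ 8 ∷ ○ 9 ∷ ● 6 ∷ ○ 0 ∷ ○ 3 ∷ ● 4 ∷ ○ 5 ∷ ○ 7 ∷ ○ 2 ∷ ○ 1 ∷ [])
  ∷ (○ 2 ∷ ○ 1 ∷ ○ 8 ∷ ○ 6 ∷ ○ 5 ∷ ○ 0 ∷ ○ 9 ∷ ○ 3 ∷ ○ 4 ∷ ○ 7 ∷ [])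
  ∷ (○ 3 ∷ ○ 4 ∷ ○ 1 ∷ ○ 7 ∷ ○ 0 ∷ ○ 8 ∷ ○ 6 ∷ ○ 5 ∷ ○ 9 ∷ ○ 2 ∷ [])
  ∷ (○ 1 ∷ ● 8 ∷ ○ 0 ∷ ○ 9 ∷ ● 6 ∷ ○ 5 ∷ ○ 3 ∷ ○ 2 ∷ ○ 7 ∷ ○ 4 ∷ [])
  ∷ (○ 9 ∷ ○ 5 ∷ ○ 3 ∷ ○ 4 ∷ ○ 2 ∷ ○ 1 ∷ ○ 7 ∷ ○ 6 ∷ ○ 8 ∷ ○ 0 ∷ [])
  ∷ (○ 6 ∷ ○ 7 ∷ ● 9 ∷ ○ 3 ∷ ● 4 ∷ ○ 2 ∷ ○ 0 ∷ ○ 8 ∷ ○ 1 ∷ ○ 5 ∷ [])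
  ∷ (● 7 ∷ ○ 2 ∷ ○ 4 ∷ ● 5 ∷ ○ 9 ∷ ○ 3 ∷ ○ 1 ∷ ○ 0 ∷ ○ 6 ∷ ○ 8 ∷ [])
  ∷ (○ 0 ∷ ● 6 ∷ ○ 5 ∷ ● 8 ∷ ○ 1 ∷ ○ 7 ∷ ○ 2 ∷ ○ 4 ∷ ○ 3 ∷ ○ 9 ∷ [])
  ∷ (○ 4 ∷ ○ 0 ∷ ○ 2 ∷ ○ 1 ∷ ○ 7 ∷ ○ 6 ∷ ○ 8 ∷ ○ 9 ∷ ○ 5 ∷ ○ 3 ∷ [])
  ∷ [] )

PVX : ColouredSquare
PVX = colouredSquare
  ( (● 6 ∷ ● 7 ∷ ● 5 ∷ ● 4 ∷ ● 8 ∷ ● 9 ∷ ○ 3 ∷ ○ 1 ∷ ○ 0 ∷ ○ 2 ∷ [])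
  ∷ (○ 2 ∷ ○ 6 ∷ ○ 3 ∷ ○ 0 ∷ ○ 7 ∷ ○ 8 ∷ ○ 4 ∷ ○ 5 ∷ ○ 1 ∷ ○ 9 ∷ [])
  ∷ (● 9 ∷ ○ 2 ∷ ○ 4 ∷ ○ 1 ∷ ● 6 ∷ ○ 7 ∷ ○ 0 ∷ ○ 3 ∷ ○ 5 ∷ ○ 8 ∷ [])
  ∷ (○ 8 ∷ ○ 9 ∷ ○ 0 ∷ ● 5 ∷ ○ 1 ∷ ● 6 ∷ ○ 2 ∷ ○ 4 ∷ ○ 3 ∷ ○ 7 ∷ [])
  ∷ (○ 7 ∷ ○ 8 ∷ ○ 2 ∷ ○ 3 ∷ ○ 5 ∷ ○ 1 ∷ ○ 9 ∷ ○ 0 ∷ ○ 4 ∷ ○ 6 ∷ [])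
  ∷ (○ 0 ∷ ● 4 ∷ ● 9 ∷ ○ 7 ∷ ○ 3 ∷ ○ 5 ∷ ○ 8 ∷ ○ 2 ∷ ○ 6 ∷ ○ 1 ∷ [])
  ∷ (○ 1 ∷ ○ 0 ∷ ○ 8 ∷ ○ 6 ∷ ○ 4 ∷ ○ 3 ∷ ○ 7 ∷ ○ 9 ∷ ○ 2 ∷ ○ 5 ∷ [])
  ∷ (○ 5 ∷ ○ 1 ∷ ○ 7 ∷ ○ 2 ∷ ○ 0 ∷ ○ 4 ∷ ○ 6 ∷ ○ 8 ∷ ○ 9 ∷ ○ 3 ∷ [])
  ∷ (○ 3 ∷ ○ 5 ∷ ○ 6 ∷ ○ 9 ∷ ○ 2 ∷ ○ 0 ∷ ○ 1 ∷ ○ 7 ∷ ○ 8 ∷ ○ 4 ∷ [])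
  ∷ (○ 4 ∷ ○ 3 ∷ ○ 1 ∷ ○ 8 ∷ ○ 9 ∷ ○ 2 ∷ ○ 5 ∷ ○ 6 ∷ ○ 7 ∷ ○ 0 ∷ [])
  ∷ [] )

QVX : ColouredSquare
QVX = colouredSquare
  ( (● 6 ∷ ● 4 ∷ ○ 8 ∷ ○ 0 ∷ ○ 5 ∷ ○ 2 ∷ ○ 1 ∷ ○ 3 ∷ ○ 9 ∷ ○ 7 ∷ [])
  ∷ (○ 0 ∷ ○ 8 ∷ ○ 4 ∷ ● 5 ∷ ○ 2 ∷ ● 9 ∷ ○ 7 ∷ ○ 6 ∷ ○ 1 ∷ ○ 3 ∷ [])
  ∷ (○ 7 ∷ ○ 1 ∷ ○ 3 ∷ ● 4 ∷ ○ 9 ∷ ● 6 ∷ ○ 0 ∷ ○ 2 ∷ ○ 8 ∷ ○ 5 ∷ [])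
  ∷ (○ 5 ∷ ○ 6 ∷ ● 9 ∷ ○ 1 ∷ ● 8 ∷ ○ 3 ∷ ○ 2 ∷ ○ 0 ∷ ○ 7 ∷ ○ 4 ∷ [])
  ∷ (○ 4 ∷ ○ 5 ∷ ○ 0 ∷ ○ 2 ∷ ○ 7 ∷ ○ 1 ∷ ○ 3 ∷ ○ 9 ∷ ○ 6 ∷ ○ 8 ∷ [])
  ∷ (○ 3 ∷ ○ 9 ∷ ○ 1 ∷ ○ 6 ∷ ○ 0 ∷ ○ 7 ∷ ○ 8 ∷ ○ 5 ∷ ○ 4 ∷ ○ 2 ∷ [])
  ∷ (○ 8 ∷ ○ 3 ∷ ○ 2 ∷ ○ 7 ∷ ○ 4 ∷ ○ 0 ∷ ○ 6 ∷ ○ 1 ∷ ○ 5 ∷ ○ 9 ∷ [])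
  ∷ (○ 1 ∷ ○ 2 ∷ ○ 7 ∷ ○ 9 ∷ ○ 3 ∷ ○ 8 ∷ ○ 5 ∷ ○ 4 ∷ ○ 0 ∷ ○ 6 ∷ [])
  ∷ (● 9 ∷ ● 7 ∷ ○ 6 ∷ ○ 3 ∷ ○ 1 ∷ ○ 5 ∷ ○ 4 ∷ ○ 8 ∷ ○ 2 ∷ ○ 0 ∷ [])
  ∷ (○ 2 ∷ ○ 0 ∷ ● 5 ∷ ○ 8 ∷ ● 6 ∷ ○ 4 ∷ ○ 9 ∷ ○ 7 ∷ ○ 3 ∷ ○ 1 ∷ [])
  ∷ [] )

PWW : ColouredSquare
PWW = colouredSquare
  ( (○ 5 ∷ ● 7 ∷ ○ 2 ∷ ○ 0 ∷ ● 8 ∷ ○ 9 ∷ ○ 3 ∷ ○ 6 ∷ ○ 4 ∷ ○ 1 ∷ [])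
  ∷ (○ 4 ∷ ○ 8 ∷ ○ 1 ∷ ○ 3 ∷ ○ 2 ∷ ○ 7 ∷ ○ 0 ∷ ○ 9 ∷ ○ 5 ∷ ○ 6 ∷ [])
  ∷ (○ 9 ∷ ○ 3 ∷ ○ 4 ∷ ○ 1 ∷ ○ 6 ∷ ○ 0 ∷ ○ 2 ∷ ○ 7 ∷ ○ 8 ∷ ○ 5 ∷ [])
  ∷ (○ 3 ∷ ● 5 ∷ ● 9 ∷ ○ 4 ∷ ○ 1 ∷ ○ 8 ∷ ○ 6 ∷ ○ 2 ∷ ○ 0 ∷ ○ 7 ∷ [])
  ∷ (○ 0 ∷ ○ 2 ∷ ○ 8 ∷ ○ 9 ∷ ○ 5 ∷ ○ 1 ∷ ○ 7 ∷ ○ 4 ∷ ○ 6 ∷ ○ 3 ∷ [])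
  ∷ (● 6 ∷ ○ 9 ∷ ○ 0 ∷ ○ 2 ∷ ○ 4 ∷ ● 5 ∷ ○ 1 ∷ ○ 3 ∷ ○ 7 ∷ ○ 8 ∷ [])
  ∷ (○ 2 ∷ ○ 4 ∷ ○ 7 ∷ ○ 6 ∷ ○ 0 ∷ ○ 3 ∷ ○ 5 ∷ ○ 8 ∷ ○ 1 ∷ ○ 9 ∷ [])
  ∷ (○ 8 ∷ ○ 1 ∷ ● 5 ∷ ● 7 ∷ ○ 3 ∷ ○ 6 ∷ ○ 9 ∷ ○ 0 ∷ ○ 2 ∷ ○ 4 ∷ [])
  ∷ (● 7 ∷ ○ 0 ∷ ○ 6 ∷ ● 5 ∷ ● 9 ∷ ● 4 ∷ ○ 8 ∷ ○ 1 ∷ ○ 3 ∷ ○ 2 ∷ [])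
  ∷ (○ 1 ∷ ○ 6 ∷ ○ 3 ∷ ○ 8 ∷ ○ 7 ∷ ○ 2 ∷ ○ 4 ∷ ○ 5 ∷ ○ 9 ∷ ○ 0 ∷ [])
  ∷ [] )

QWW : ColouredSquare
QWW = colouredSquare
  ( (● 6 ∷ ● 7 ∷ ● 5 ∷ ○ 3 ∷ ● 9 ∷ ○ 8 ∷ ○ 2 ∷ ○ 4 ∷ ○ 1 ∷ ○ 0 ∷ [])
  ∷ (○ 4 ∷ ○ 1 ∷ ○ 6 ∷ ○ 2 ∷ ○ 5 ∷ ○ 0 ∷ ○ 3 ∷ ○ 8 ∷ ○ 9 ∷ ○ 7 ∷ [])
  ∷ (○ 1 ∷ ○ 0 ∷ ○ 4 ∷ ○ 6 ∷ ○ 3 ∷ ○ 9 ∷ ○ 7 ∷ ○ 2 ∷ ○ 5 ∷ ○ 8 ∷ [])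
  ∷ (○ 3 ∷ ○ 6 ∷ ○ 7 ∷ ○ 0 ∷ ○ 4 ∷ ○ 1 ∷ ○ 8 ∷ ○ 9 ∷ ○ 2 ∷ ○ 5 ∷ [])
  ∷ (● 7 ∷ ○ 4 ∷ ○ 3 ∷ ○ 9 ∷ ○ 2 ∷ ● 5 ∷ ○ 6 ∷ ○ 0 ∷ ○ 8 ∷ ○ 1 ∷ [])
  ∷ (○ 8 ∷ ● 5 ∷ ○ 2 ∷ ○ 1 ∷ ○ 7 ∷ ● 4 ∷ ○ 0 ∷ ○ 3 ∷ ○ 6 ∷ ○ 9 ∷ [])
  ∷ (○ 5 ∷ ○ 3 ∷ ○ 8 ∷ ○ 4 ∷ ○ 0 ∷ ○ 2 ∷ ○ 9 ∷ ○ 1 ∷ ○ 7 ∷ ○ 6 ∷ [])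
  ∷ (○ 9 ∷ ○ 2 ∷ ○ 0 ∷ ○ 8 ∷ ○ 1 ∷ ○ 7 ∷ ○ 5 ∷ ○ 6 ∷ ○ 3 ∷ ○ 4 ∷ [])
  ∷ (○ 2 ∷ ○ 9 ∷ ○ 1 ∷ ● 5 ∷ ● 8 ∷ ○ 6 ∷ ○ 4 ∷ ○ 7 ∷ ○ 0 ∷ ○ 3 ∷ [])
  ∷ (○ 0 ∷ ○ 8 ∷ ● 9 ∷ ● 7 ∷ ○ 6 ∷ ○ 3 ∷ ○ 1 ∷ ○ 5 ∷ ○ 4 ∷ ○ 2 ∷ [])
  ∷ [] )

PWX : ColouredSquare
PWX = colouredSquare
  ( (○ 7 ∷ ● 8 ∷ ● 9 ∷ ○ 4 ∷ ○ 1 ∷ ○ 0 ∷ ○ 3 ∷ ○ 2 ∷ ○ 5 ∷ ○ 6 ∷ [])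
  ∷ (○ 4 ∷ ○ 1 ∷ ○ 5 ∷ ○ 0 ∷ ○ 2 ∷ ○ 6 ∷ ○ 9 ∷ ○ 8 ∷ ○ 3 ∷ ○ 7 ∷ [])
  ∷ (○ 9 ∷ ○ 5 ∷ ○ 7 ∷ ○ 2 ∷ ○ 0 ∷ ○ 3 ∷ ○ 6 ∷ ○ 1 ∷ ○ 8 ∷ ○ 4 ∷ [])
  ∷ (● 8 ∷ ○ 2 ∷ ○ 3 ∷ ○ 7 ∷ ○ 4 ∷ ● 9 ∷ ○ 5 ∷ ○ 6 ∷ ○ 1 ∷ ○ 0 ∷ [])
  ∷ (○ 0 ∷ ● 7 ∷ ● 6 ∷ ● 5 ∷ ○ 8 ∷ ● 4 ∷ ○ 1 ∷ ○ 3 ∷ ○ 2 ∷ ○ 9 ∷ [])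
  ∷ (○ 1 ∷ ○ 6 ∷ ○ 4 ∷ ○ 3 ∷ ○ 9 ∷ ○ 2 ∷ ○ 0 ∷ ○ 5 ∷ ○ 7 ∷ ○ 8 ∷ [])
  ∷ (○ 2 ∷ ○ 0 ∷ ○ 8 ∷ ○ 6 ∷ ○ 3 ∷ ○ 5 ∷ ○ 7 ∷ ○ 9 ∷ ○ 4 ∷ ○ 1 ∷ [])
  ∷ (○ 3 ∷ ○ 4 ∷ ○ 1 ∷ ● 9 ∷ ● 7 ∷ ○ 8 ∷ ○ 2 ∷ ○ 0 ∷ ○ 6 ∷ ○ 5 ∷ [])
  ∷ (● 5 ∷ ○ 9 ∷ ○ 2 ∷ ○ 1 ∷ ● 6 ∷ ○ 7 ∷ ○ 8 ∷ ○ 4 ∷ ○ 0 ∷ ○ 3 ∷ [])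
  ∷ (○ 6 ∷ ○ 3 ∷ ○ 0 ∷ ○ 8 ∷ ○ 5 ∷ ○ 1 ∷ ○ 4 ∷ ○ 7 ∷ ○ 9 ∷ ○ 2 ∷ [])
  ∷ [] )

QWX : ColouredSquare
QWX = colouredSquare
  ( (○ 4 ∷ ● 7 ∷ ○ 2 ∷ ○ 8 ∷ ○ 0 ∷ ● 9 ∷ ○ 3 ∷ ○ 5 ∷ ○ 6 ∷ ○ 1 ∷ [])
  ∷ (○ 2 ∷ ● 8 ∷ ○ 4 ∷ ● 9 ∷ ○ 5 ∷ ○ 3 ∷ ○ 1 ∷ ○ 6 ∷ ○ 0 ∷ ○ 7 ∷ [])
  ∷ (● 8 ∷ ○ 9 ∷ ○ 5 ∷ ○ 2 ∷ ● 7 ∷ ○ 1 ∷ ○ 0 ∷ ○ 3 ∷ ○ 4 ∷ ○ 6 ∷ [])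
  ∷ (○ 6 ∷ ○ 5 ∷ ○ 1 ∷ ○ 7 ∷ ○ 3 ∷ ○ 0 ∷ ○ 9 ∷ ○ 4 ∷ ○ 2 ∷ ○ 8 ∷ [])
  ∷ (○ 1 ∷ ○ 2 ∷ ○ 0 ∷ ○ 4 ∷ ○ 8 ∷ ○ 7 ∷ ○ 6 ∷ ○ 9 ∷ ○ 3 ∷ ○ 5 ∷ [])
  ∷ (○ 3 ∷ ○ 0 ∷ ● 9 ∷ ● 5 ∷ ○ 4 ∷ ○ 6 ∷ ○ 8 ∷ ○ 1 ∷ ○ 7 ∷ ○ 2 ∷ [])
  ∷ (○ 7 ∷ ○ 6 ∷ ○ 3 ∷ ○ 1 ∷ ○ 2 ∷ ○ 5 ∷ ○ 4 ∷ ○ 0 ∷ ○ 8 ∷ ○ 9 ∷ [])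
  ∷ (● 5 ∷ ○ 3 ∷ ● 6 ∷ ○ 0 ∷ ○ 9 ∷ ○ 8 ∷ ○ 7 ∷ ○ 2 ∷ ○ 1 ∷ ○ 4 ∷ [])
  ∷ (○ 0 ∷ ○ 4 ∷ ○ 7 ∷ ○ 6 ∷ ○ 1 ∷ ○ 2 ∷ ○ 5 ∷ ○ 8 ∷ ○ 9 ∷ ○ 3 ∷ [])
  ∷ (○ 9 ∷ ○ 1 ∷ ○ 8 ∷ ○ 3 ∷ ● 6 ∷ ● 4 ∷ ○ 2 ∷ ○ 7 ∷ ○ 5 ∷ ○ 0 ∷ [])
  ∷ [] )

PXX : ColouredSquare
PXX = colouredSquare
  ( (○ 0 ∷ ○ 1 ∷ ○ 5 ∷ ● 4 ∷ ● 8 ∷ ○ 7 ∷ ○ 3 ∷ ○ 9 ∷ ○ 2 ∷ ○ 6 ∷ [])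
  ∷ (○ 2 ∷ ● 9 ∷ ○ 4 ∷ ○ 7 ∷ ○ 3 ∷ ● 8 ∷ ○ 5 ∷ ○ 1 ∷ ○ 6 ∷ ○ 0 ∷ [])
  ∷ (○ 3 ∷ ○ 5 ∷ ● 8 ∷ ○ 2 ∷ ○ 7 ∷ ● 6 ∷ ○ 9 ∷ ○ 0 ∷ ○ 4 ∷ ○ 1 ∷ [])
  ∷ (○ 7 ∷ ○ 2 ∷ ○ 3 ∷ ○ 9 ∷ ○ 6 ∷ ○ 1 ∷ ○ 0 ∷ ○ 4 ∷ ○ 5 ∷ ○ 8 ∷ [])
  ∷ (● 6 ∷ ○ 7 ∷ ● 9 ∷ ○ 5 ∷ ○ 0 ∷ ○ 2 ∷ ○ 1 ∷ ○ 3 ∷ ○ 8 ∷ ○ 4 ∷ [])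
  ∷ (○ 5 ∷ ○ 3 ∷ ○ 0 ∷ ○ 1 ∷ ○ 4 ∷ ○ 9 ∷ ○ 8 ∷ ○ 6 ∷ ○ 7 ∷ ○ 2 ∷ [])
  ∷ (○ 1 ∷ ○ 0 ∷ ○ 2 ∷ ○ 8 ∷ ○ 9 ∷ ○ 4 ∷ ○ 6 ∷ ○ 5 ∷ ○ 3 ∷ ○ 7 ∷ [])
  ∷ (○ 8 ∷ ○ 6 ∷ ○ 7 ∷ ○ 0 ∷ ○ 1 ∷ ○ 3 ∷ ○ 4 ∷ ○ 2 ∷ ○ 9 ∷ ○ 5 ∷ [])
  ∷ (● 4 ∷ ○ 8 ∷ ○ 6 ∷ ○ 3 ∷ ● 5 ∷ ○ 0 ∷ ○ 2 ∷ ○ 7 ∷ ○ 1 ∷ ○ 9 ∷ [])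
  ∷ (○ 9 ∷ ● 4 ∷ ○ 1 ∷ ● 6 ∷ ○ 2 ∷ ○ 5 ∷ ○ 7 ∷ ○ 8 ∷ ○ 0 ∷ ○ 3 ∷ [])
  ∷ [] )

QXX : ColouredSquare
QXX = colouredSquare
  ( (○ 0 ∷ ○ 2 ∷ ● 8 ∷ ○ 7 ∷ ● 5 ∷ ○ 4 ∷ ○ 1 ∷ ○ 6 ∷ ○ 9 ∷ ○ 3 ∷ [])
  ∷ (○ 8 ∷ ○ 1 ∷ ○ 3 ∷ ○ 5 ∷ ○ 2 ∷ ○ 9 ∷ ○ 6 ∷ ○ 7 ∷ ○ 4 ∷ ○ 0 ∷ [])
  ∷ (○ 7 ∷ ● 4 ∷ ○ 0 ∷ ○ 8 ∷ ○ 1 ∷ ● 6 ∷ ○ 5 ∷ ○ 3 ∷ ○ 2 ∷ ○ 9 ∷ [])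
  ∷ (○ 9 ∷ ○ 3 ∷ ○ 5 ∷ ○ 2 ∷ ○ 6 ∷ ○ 0 ∷ ○ 4 ∷ ○ 1 ∷ ○ 8 ∷ ○ 7 ∷ [])
  ∷ (○ 3 ∷ ○ 7 ∷ ○ 2 ∷ ● 6 ∷ ○ 4 ∷ ● 8 ∷ ○ 0 ∷ ○ 9 ∷ ○ 1 ∷ ○ 5 ∷ [])
  ∷ (○ 5 ∷ ● 9 ∷ ○ 6 ∷ ○ 0 ∷ ● 8 ∷ ○ 2 ∷ ○ 7 ∷ ○ 4 ∷ ○ 3 ∷ ○ 1 ∷ [])
  ∷ (● 4 ∷ ○ 0 ∷ ● 9 ∷ ○ 1 ∷ ○ 7 ∷ ○ 5 ∷ ○ 3 ∷ ○ 2 ∷ ○ 6 ∷ ○ 8 ∷ [])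
  ∷ (● 6 ∷ ○ 8 ∷ ○ 7 ∷ ● 4 ∷ ○ 3 ∷ ○ 1 ∷ ○ 9 ∷ ○ 5 ∷ ○ 0 ∷ ○ 2 ∷ [])
  ∷ (○ 1 ∷ ○ 5 ∷ ○ 4 ∷ ○ 9 ∷ ○ 0 ∷ ○ 3 ∷ ○ 2 ∷ ○ 8 ∷ ○ 7 ∷ ○ 6 ∷ [])
  ∷ (○ 2 ∷ ○ 6 ∷ ○ 1 ∷ ○ 3 ∷ ○ 9 ∷ ○ 7 ∷ ○ 8 ∷ ○ 0 ∷ ○ 5 ∷ ○ 4 ∷ [])
  ∷ [] )

realisedBy : (τ τ' : Type) (P Q : ColouredSquare) → True (realises? τ τ' P Q) →
  Σ ColouredSquare λ P → Σ ColouredSquare λ Q → Realises τ τ' P Q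
realisedBy _ _ P Q certified = P , Q , toWitness certified

mainTheorem1 : ∀ {τ τ' : Type} → Pair τ τ' →
    Σ ColouredSquare λ P → Σ ColouredSquare λ Q →
      Admissible τ P × Admissible τ' Q × IsTRP (sq P) (sq Q) × Consistent P Q
      × ((Compatible (sq P) Ω₁ × Compatible (sq Q) Ω₁) ⊎ (Compatible (sq P) Ω₂ × Compatible (sq Q) Ω₂))
mainTheorem1 SX = realisedBy S X PSX QSX _
mainTheorem1 UU = realisedBy U U PUU QUU _
mainTheorem1 UW = realisedBy U W PUW QUW _
mainTheorem1 UX = realisedBy U X PUX QUX _
mainTheorem1 VX = realisedBy V X PVX QVX _
mainTheorem1 WW = realisedBy W W PWW QWW _
mainTheorem1 WX = realisedBy W X PWX QWX _
mainTheorem1 XX = realisedBy X X PXX QXX _
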